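{- Let $n \ge m \ge 2$ be integers. The outcome of the Maker-Breaker domination game on $K_{1,m} \square K_{1,n}$ is $\mathcal{D}$ if $m=n=2$; it is $\mathcal{N}$ if $m=2$ and $n \ge 3$; and it is $\mathcal{S}$ if $n \ge m \ge 3$.
   Context: The Maker-Breaker domination game on a finite graph $G$ is played by Dominator and Staller, who alternately claim a previously unplayed vertex of $G$ until all vertices are played. Dominator wins if his claimed vertices form a dominating set of $G$; otherwise Staller wins (equivalently, she claims all vertices of some closed neighborhood $N_G[v]$). The D-game is the game where Dominator moves first, the S-game where Staller moves first. The outcome $o(G)$ is $\mathcal{D}$ if Dominator has a winning strategy in both the D-game and the S-game, $\mathcal{S}$ if Staller has a winning strategy in both games, and $\mathcal{N}$ if the player who moves first has a winning strategy in each game. $K_{1,k}$ is the star with $k$ leaves and $\square$ is the Cartesian product of graphs. -}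

module Defs where

open import Level using (0ℓ)
open import Data.Nat using (ℕ; suc)
open import Data.Fin using (Fin; zero)
open import Data.Product using (_×_; _,_; ∃)
open import Data.Sum using (_⊎_)
open import Relation.Nullary using (¬_; yes; no)
open import Relation.Binary.PropositionalEquality using (_≡_; _≢_)
open import Relation.Binary.Definitions using (DecidableEquality)
open import Data.Fin.Properties using () renaming (_≟_ to _≟F_)
open import Data.Product.Properties using (≡-dec)

record Graph : Set₁ where
  field
    V   : Set
    _≟_ : DecidableEquality V
    Adj : V → V → Set
open Graph public

-- Star K_{1,k}: centre is zero, leaves are the k nonzero elements of Fin (suc k).
Star : ℕ → Graph
Star k = record
  { V   = Fin (suc k)
  ; _≟_ = _≟F_
  ; Adj = λ x y → (x ≡ zero × y ≢ zero) ⊎ (y ≡ zero × x ≢ zero)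
  }

_□_ : Graph → Graph → Graph
G □ H = record
  { V   = V G × V H
  ; _≟_ = ≡-dec (_≟_ G) (_≟_ H)
  ; Adj = λ { (a , b) (a' , b') → (Adj G a a' × b ≡ b') ⊎ (a ≡ a' × Adj H b b') }
  }

data Cell : Set where
  free dom sta : Cell

data Player : Set where
  Dominator Staller : Player

module Game (G : Graph) where
  Position : Set
  Position = V G → Cell

  start : Position
  start _ = free

  claim : Position → V G → Cell → Position
  claim p v c w with _≟_ G v w
  ... | yes _ = c
  ... | no  _ = p w

  AllPlayed : Position → Set
  AllPlayed p = ∀ v → p v ≢ free

  DomDominates : Position → Set
  DomDominates p = ∀ v → ∃ λ u → p u ≡ dom × (u ≡ v ⊎ Adj G u v)

  data DWins : Position → Player → Set where
    dEnd  : ∀ {p who} → AllPlayed p → DomDominates p → DWins p who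
    dMove : ∀ {p} v → p v ≡ free → DWins (claim p v dom) Staller → DWins p Dominator
    sMove : ∀ {p} → ¬ AllPlayed p →
            (∀ v → p v ≡ free → DWins (claim p v sta) Dominator) → DWins p Staller

  data SWins : Position → Player → Set where
    sEnd  : ∀ {p who} → AllPlayed p → ¬ DomDominates p → SWins p who
    sMove : ∀ {p} v → p v ≡ free → SWins (claim p v sta) Dominator → SWins p Staller
    dMove : ∀ {p} → ¬ AllPlayed p →
            (∀ v → p v ≡ free → SWins (claim p v dom) Staller) → SWins p Dominator

data Outcome : Set where
  𝒟 𝒩 𝒮 : Outcome

-- o(G) = o : D-game starts with Dominator to move, S-game with Staller.
HasOutcome : Graph → Outcome → Set
HasOutcome G 𝒟 = DWins start Dominator × DWins start Staller  where open Game G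
HasOutcome G 𝒮 = SWins start Dominator × SWins start Staller  where open Game G
HasOutcome G 𝒩 = DWins start Dominator × SWins start Staller  where open Game G

-- Staller wins as soon as she owns a closed neighbourhood; a threat (a closed neighbourhood with a
-- single free vertex left) forces Dominator's reply, and two threats at once win.  In K_{1,m} □ K_{1,n}
-- write x for the pair of centres, a i and b j for the vertices pairing a leaf of one factor with the
-- centre of the other, and c i j for the pairs of leaves, so that N[c i j] = {c i j, a i, b j}.
-- If Staller owns a i while a i′, b j, b j′ and the four c's among them are free, she claims b j, a i′
-- and b j′: the first two claims force Dominator onto c i j and c i′ j, the last one threatens c i j′
-- and c i′ j′ at once.  If instead x and the whole row through a i are free, she claims c i 0, c i 1, …,
-- each forcing Dominator onto the matching b, and her last claim threatens both its b and a i.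
-- In the S-game with m ≥ 2 and n ≥ 3 Staller opens with some a i, and one of these configurations
-- survives Dominator's reply; in the D-game with m, n ≥ 3 she answers his first vertex by a vertex a i
-- (or b j) off its row (column), and a configuration survives his second vertex.
-- For m = 2 Dominator wins by pairing strategies: in the D-game he claims a 0, after which the
-- vertices (0 , s) and (2 , s) of each column pair off; in the S-game on K_{1,2} □ K_{1,2} a reply and
-- a pairing for each first move of Staller are checked by computation.

module Submission where

open import Defs
open import Data.Nat using (ℕ; zero; suc; _+_; _≤_; _<_; _≥_; z≤n; s≤s; z<s)
open import Data.Nat.Properties
  using (≤-refl; ≤-trans; <⇒≤; <-trans; <-≤-trans; +-mono-≤; +-mono-<-≤; +-mono-≤-<)
open import Data.Nat.Induction using (<-wellFounded)
open import Induction.WellFounded using (Acc; acc)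
open import Data.Fin using (Fin; zero; suc)
open import Data.Fin.Properties using (suc-injective) renaming (_≟_ to _≟ᶠ_)
open import Data.Product using (∃; _×_; _,_; proj₁; proj₂; swap)
open import Data.Sum using (_⊎_; inj₁; inj₂) renaming (map to ⊎-map; swap to ⊎-swap)
open import Data.Empty using (⊥-elim)
open import Data.List using (List; []; _∷_; cartesianProduct; allFin)
open import Data.List.Membership.Propositional.Properties using (∈-cartesianProduct⁺; ∈-allFin)
open import Data.List.Membership.Propositional using (_∈_; lose)
open import Data.List.Relation.Unary.Any using (Any; here; there; any?; satisfied)
open import Data.List.Relation.Unary.All using (All; all?)
import Data.List.Relation.Unary.All as All
open import Relation.Nullary using (¬_; Dec; yes; no)
open import Relation.Nullary.Decidable using (_⊎-dec_; _×-dec_; ¬?; toWitness)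
open import Data.Unit using (tt)
open import Function using (id; _∘_; case_of_)
open import Relation.Binary.Definitions using (DecidableEquality)
open import Relation.Binary.PropositionalEquality using (_≡_; _≢_; refl; sym; trans; cong; subst; ≢-sym)

_≟ᶜ_ : DecidableEquality Cell
free ≟ᶜ free = yes refl
dom  ≟ᶜ dom  = yes refl
sta  ≟ᶜ sta  = yes refl
free ≟ᶜ dom  = no λ ()
free ≟ᶜ sta  = no λ ()
dom  ≟ᶜ free = no λ ()
dom  ≟ᶜ sta  = no λ ()
sta  ≟ᶜ free = no λ ()
sta  ≟ᶜ dom  = no λ ()

weight : Cell → ℕ
weight free = 1
weight dom = 0
weight sta = 0

weight-played : ∀ {c} → c ≢ free → weight c ≡ 0
weight-played {free} c≢free = ⊥-elim (c≢free refl)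
weight-played {dom} _ = refl
weight-played {sta} _ = refl

data Side : Set where
  hub one two : Side

_≟ˢ_ : DecidableEquality Side
hub ≟ˢ hub = yes refl
one ≟ˢ one = yes refl
two ≟ˢ two = yes refl
hub ≟ˢ one = no λ ()
hub ≟ˢ two = no λ ()
one ≟ˢ hub = no λ ()
one ≟ˢ two = no λ ()
two ≟ˢ hub = no λ ()
two ≟ˢ one = no λ ()

Board : Set
Board = Side → Side → Cell

blank : Board
blank _ _ = free

mark : Board → Side → Side → Cell → Board
mark σ k l c k′ l′ with k ≟ˢ k′ | l ≟ˢ l′
... | yes _ | yes _ = c
... | _     | _     = σ k′ l′

module FiniteGame (G : Graph) (vertices : List (V G)) (∈-vertices : ∀ v → v ∈ vertices)
                  (adj? : ∀ u v → Dec (Adj G u v)) where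
  open Game G public

  -- Claims and termination

  _∈N[_] : V G → V G → Set
  u ∈N[ t ] = u ≡ t ⊎ Adj G u t

  _≟ᵥ_ : DecidableEquality (V G)
  _≟ᵥ_ = _≟_ G

  _∈N?[_] : ∀ u t → Dec (u ∈N[ t ])
  u ∈N?[ t ] = u ≟ᵥ t ⊎-dec adj? u t

  claim-here : ∀ p v c → claim p v c v ≡ c
  claim-here p v c with v ≟ᵥ v
  ... | yes _ = refl
  ... | no v≢v = ⊥-elim (v≢v refl)

  claim-elsewhere : ∀ p {v} c {w} → w ≢ v → claim p v c w ≡ p w
  claim-elsewhere p {v} c {w} w≢v with v ≟ᵥ w
  ... | yes v≡w = ⊥-elim (w≢v (sym v≡w))
  ... | no _ = refl

  claim-preserves : ∀ {p v c w d} → w ≢ v → p w ≡ d → claim p v c w ≡ d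
  claim-preserves {p} {c = c} w≢v pw = trans (claim-elsewhere p c w≢v) pw

  played≢free : ∀ {p : Position} {v w d} → p v ≡ free → p w ≡ d → d ≢ free → w ≢ v
  played≢free pv pw d≢free refl = d≢free (trans (sym pw) pv)

  sta-stays : ∀ {p v c w} → p v ≡ free → p w ≡ sta → claim p v c w ≡ sta
  sta-stays pv pw = claim-preserves (played≢free pv pw λ ()) pw

  dom-stays : ∀ {p v c w} → p v ≡ free → p w ≡ dom → claim p v c w ≡ dom
  dom-stays pv pw = claim-preserves (played≢free pv pw λ ()) pw

  unplayed : Position → List (V G) → ℕ
  unplayed p [] = 0
  unplayed p (v ∷ vs) = weight (p v) + unplayed p vs

  claim-weight-≤ : ∀ {p v c} → c ≢ free → ∀ w → weight (claim p v c w) ≤ weight (p w)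
  claim-weight-≤ {p} {v} {c} c≢free w with v ≟ᵥ w
  ... | yes _ = subst (_≤ weight (p w)) (sym (weight-played c≢free)) z≤n
  ... | no _ = ≤-refl

  claim-weight-< : ∀ {p v c} → p v ≡ free → c ≢ free → weight (claim p v c v) < weight (p v)
  claim-weight-< {p} {v} {c} pv c≢free rewrite claim-here p v c | pv | weight-played c≢free = s≤s z≤n

  unplayed-claim-≤ : ∀ {p v c} → c ≢ free → ∀ vs → unplayed (claim p v c) vs ≤ unplayed p vs
  unplayed-claim-≤ c≢free [] = z≤n
  unplayed-claim-≤ c≢free (w ∷ vs) = +-mono-≤ (claim-weight-≤ c≢free w) (unplayed-claim-≤ c≢free vs)

  unplayed-claim-< : ∀ {p v c vs} → p v ≡ free → c ≢ free → v ∈ vs →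
                     unplayed (claim p v c) vs < unplayed p vs
  unplayed-claim-< {p} {v} {c} {_ ∷ vs} pv c≢free (here refl) =
    +-mono-<-≤ (claim-weight-< pv c≢free) (unplayed-claim-≤ {p} {v} {c} c≢free vs)
  unplayed-claim-< {p} {v} {c} {w ∷ _} pv c≢free (there v∈vs) =
    +-mono-≤-< (claim-weight-≤ {p} {v} {c} c≢free w) (unplayed-claim-< pv c≢free v∈vs)

  Terminates : Position → Set
  Terminates p = Acc _<_ (unplayed p vertices)

  terminates : ∀ p → Terminates p
  terminates p = <-wellFounded _

  claim-decreases : ∀ {p v c} → p v ≡ free → c ≢ free → unplayed (claim p v c) vertices < unplayed p vertices
  claim-decreases {v = v} pv c≢free = unplayed-claim-< pv c≢free (∈-vertices v)

  free-vertex? : ∀ p → (∃ λ v → p v ≡ free) ⊎ AllPlayed p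
  free-vertex? p with any? (λ v → p v ≟ᶜ free) vertices
  ... | yes found = inj₁ (satisfied found)
  ... | no none = inj₂ λ v pv → none (lose (∈-vertices v) pv)

  free⇒≢claimed : ∀ {p v c w} → claim p v c w ≡ free → c ≢ free → w ≢ v
  free⇒≢claimed {p} {v} {c} pw c≢free refl = c≢free (trans (sym (claim-here p v c)) pw)

  -- Threats

  StallerHolds : Position → V G → Set
  StallerHolds p t = ∀ {u} → u ∈N[ t ] → p u ≡ sta

  holds-claim : ∀ {p t w c} → p w ≡ free → StallerHolds p t → StallerHolds (claim p w c) t
  holds-claim pw holds u∈N = sta-stays pw (holds u∈N)

  holds⇒SWins : ∀ {p t} who → StallerHolds p t → Terminates p → SWins p who
  holds⇒SWins {p} {t} who holds (acc smaller) with free-vertex? p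
  ... | inj₂ allPlayed = sEnd allPlayed undominated
    where
    undominated : ¬ DomDominates p
    undominated dominates with dominates t
    ... | u , pu , u∈N with () ← trans (sym pu) (holds u∈N)
  ... | inj₁ (v , pv) with who
  ...   | Staller = sMove v pv (holds⇒SWins Dominator (holds-claim pv holds) (smaller (claim-decreases pv λ ())))
  ...   | Dominator = dMove (λ allPlayed → allPlayed v pv) λ w pw →
                        holds⇒SWins Staller (holds-claim pw holds) (smaller (claim-decreases pw λ ()))

  Threat : Position → V G → V G → Set
  Threat p t f = p f ≡ free × (∀ {u} → u ∈N[ t ] → u ≡ f ⊎ p u ≡ sta)

  threat-realised : ∀ {p t f w} → Threat p t f → p w ≡ free → w ≢ f →
                    StallerHolds (claim (claim p w dom) f sta) t
  threat-realised {f = f} (pf , rest) pw w≢f u∈N with rest u∈N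
  ... | inj₁ refl = claim-here _ f sta
  ... | inj₂ pu = sta-stays (claim-preserves (≢-sym w≢f) pf) (sta-stays pw pu)

  threat-completed : ∀ {p t f w} → Threat p t f → p w ≡ free → w ≢ f → SWins (claim p w dom) Staller
  threat-completed threat@(pf , _) pw w≢f =
    sMove _ (claim-preserves (≢-sym w≢f) pf) (holds⇒SWins Dominator (threat-realised threat pw w≢f) (terminates _))

  forced : ∀ {p t f} → Threat p t f → SWins (claim p f dom) Staller → SWins p Dominator
  forced {p} {f = f} threat@(pf , _) continuation = dMove (λ allPlayed → allPlayed f pf) reply
    where
    reply : ∀ w → p w ≡ free → SWins (claim p w dom) Staller
    reply w pw with w ≟ᵥ f
    ... | yes refl = continuation
    ... | no w≢f = threat-completed threat pw w≢f

  double-threat : ∀ {p t₁ f₁ t₂ f₂} → Threat p t₁ f₁ → Threat p t₂ f₂ → f₁ ≢ f₂ → SWins p Dominator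
  double-threat {p} {f₁ = f₁} threat₁@(pf₁ , _) threat₂ f₁≢f₂ =
    dMove (λ allPlayed → allPlayed f₁ pf₁) reply
    where
    reply : ∀ w → p w ≡ free → SWins (claim p w dom) Staller
    reply w pw with w ≟ᵥ f₁
    ... | yes refl = threat-completed threat₂ pw f₁≢f₂
    ... | no w≢f₁ = threat-completed threat₁ pw w≢f₁

  staller-claims : ∀ {p} s w → p s ≡ free → p w ≡ free → w ≢ s →
                    (∀ d → claim p s sta d ≡ free → SWins (claim (claim p s sta) d dom) Staller) → SWins p Staller
  staller-claims s w ps pw w≢s continue =
    sMove s ps (dMove (λ allPlayed → allPlayed w (claim-preserves w≢s pw)) continue)

  -- Pairing strategies

  module Pairing (π : V G → V G) where
    FreePair : Position → V G → Set
    FreePair p u = π u ≢ u × p u ≡ free × p (π u) ≡ free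

    DomIn : Position → V G → V G → Set
    DomIn p t u = p u ≡ dom × u ∈N[ t ]

    PairIn : Position → V G → V G → Set
    PairIn p t u = FreePair p u × u ∈N[ t ] × π u ∈N[ t ]

    Covered : Position → V G → Set
    Covered p t = ∃ (DomIn p t) ⊎ ∃ (PairIn p t)

    PairingInvariant : Position → Set
    PairingInvariant p = ∀ t → Covered p t

    PartnerFree : Position → V G → Set
    PartnerFree p v = π v ≢ v × p (π v) ≡ free

    pair-survives : ∀ {p t u v c} → PairIn p t u → u ≢ v → π u ≢ v → PairIn (claim p v c) t u
    pair-survives ((πu≢u , pu , pπu) , u∈N , πu∈N) u≢v πu≢v =
      (πu≢u , claim-preserves u≢v pu , claim-preserves πu≢v pπu) , u∈N , πu∈N

    covered-claim-dom : ∀ {p t w} → Covered p t → p w ≡ free → Covered (claim p w dom) t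
    covered-claim-dom (inj₁ (u , pu , u∈N)) pw = inj₁ (u , dom-stays pw pu , u∈N)
    covered-claim-dom {p} {w = w} (inj₂ (u , pair@(_ , u∈N , πu∈N))) pw with u ≟ᵥ w | π u ≟ᵥ w
    ... | yes refl | _ = inj₁ (u , claim-here p u dom , u∈N)
    ... | no _ | yes refl = inj₁ (π u , claim-here p (π u) dom , πu∈N)
    ... | no u≢w | no πu≢w = inj₂ (u , pair-survives pair u≢w πu≢w)

    covered⇒dominated : ∀ {p t} → Covered p t → AllPlayed p → ∃ (DomIn p t)
    covered⇒dominated (inj₁ dominated) _ = dominated
    covered⇒dominated (inj₂ (u , (_ , pu , _) , _)) allPlayed = ⊥-elim (allPlayed u pu)

    partnerFree? : ∀ p v → Dec (PartnerFree p v)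
    partnerFree? p v = ¬? (π v ≟ᵥ v) ×-dec (p (π v) ≟ᶜ free)

    module Strategy (π-involutive : ∀ v → π (π v) ≡ v) where
      covered-claim-sta : ∀ {p t v} → Covered p t → p v ≡ free → ¬ PartnerFree p v → Covered (claim p v sta) t
      covered-claim-sta (inj₁ (u , pu , u∈N)) pv _ = inj₁ (u , dom-stays pv pu , u∈N)
      covered-claim-sta {p} {v = v} (inj₂ (u , pair@((πu≢u , pu , pπu) , _))) pv partnerTaken =
        inj₂ (u , pair-survives pair u≢v πu≢v)
        where
        u≢v : u ≢ v
        u≢v refl = partnerTaken (πu≢u , pπu)
        πu≢v : π u ≢ v
        πu≢v refl = partnerTaken (subst (_≢ π u) (sym (π-involutive u)) (≢-sym πu≢u) ,
                                  subst (λ z → p z ≡ free) (sym (π-involutive u)) pu)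

      covered-pair-reply : ∀ {p t v} → Covered p t → p v ≡ free → PartnerFree p v →
                           Covered (claim (claim p v sta) (π v) dom) t
      covered-pair-reply (inj₁ (u , pu , u∈N)) pv (πv≢v , pπv) =
        inj₁ (u , dom-stays (claim-preserves πv≢v pπv) (dom-stays pv pu) , u∈N)
      covered-pair-reply {p} {v = v} (inj₂ (u , pair@(_ , u∈N , πu∈N))) pv (πv≢v , pπv)
        with u ≟ᵥ v | π u ≟ᵥ v
      ... | yes refl | _ = inj₁ (π u , claim-here _ (π u) dom , πu∈N)
      ... | no _ | yes refl =
        inj₁ (u , subst (λ z → claim (claim p (π u) sta) z dom u ≡ dom) (sym (π-involutive u))
                        (claim-here _ u dom) , u∈N)
      ... | no u≢v | no πu≢v =
        covered-claim-dom (inj₂ (u , pair-survives pair u≢v πu≢v)) (claim-preserves πv≢v pπv)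

      mutual
        pairing-strategy : ∀ {p} → PairingInvariant p → Terminates p → DWins p Staller
        pairing-strategy {p} invariant (acc smaller) with free-vertex? p
        ... | inj₂ allPlayed = dEnd allPlayed λ t → covered⇒dominated (invariant t) allPlayed
        ... | inj₁ (v₀ , pv₀) = sMove (λ allPlayed → allPlayed v₀ pv₀) reply
          where
          reply : ∀ v → p v ≡ free → DWins (claim p v sta) Dominator
          reply v pv with partnerFree? p v
          ... | yes (πv≢v , pπv) =
            dMove (π v) (claim-preserves πv≢v pπv)
              (pairing-strategy (λ t → covered-pair-reply (invariant t) pv (πv≢v , pπv))
                (smaller (<-≤-trans (claim-decreases (claim-preserves πv≢v pπv) λ ())
                                    (unplayed-claim-≤ (λ ()) vertices))))
          ... | no partnerTaken =
            any-reply (λ t → covered-claim-sta (invariant t) pv partnerTaken) (smaller (claim-decreases pv λ ()))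

        any-reply : ∀ {p} → PairingInvariant p → Terminates p → DWins p Dominator
        any-reply {p} invariant (acc smaller) with free-vertex? p
        ... | inj₂ allPlayed = dEnd allPlayed λ t → covered⇒dominated (invariant t) allPlayed
        ... | inj₁ (w , pw) =
          dMove w pw (pairing-strategy (λ t → covered-claim-dom (invariant t) pw) (smaller (claim-decreases pw λ ())))

      pairing-wins : ∀ {p} → PairingInvariant p → DWins p Staller
      pairing-wins {p} invariant = pairing-strategy invariant (terminates p)

    DomIn? : ∀ p t u → Dec (DomIn p t u)
    DomIn? p t u = (p u ≟ᶜ dom) ×-dec (u ∈N?[ t ])

    PairIn? : ∀ p t u → Dec (PairIn p t u)
    PairIn? p t u = (¬? (π u ≟ᵥ u) ×-dec (p u ≟ᶜ free) ×-dec (p (π u) ≟ᶜ free)) ×-dec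
                    (u ∈N?[ t ]) ×-dec (π u ∈N?[ t ])

    CheckedInvariant : Position → Set
    CheckedInvariant p = All (λ t → Any (DomIn p t) vertices ⊎ Any (PairIn p t) vertices) vertices

    checkedInvariant? : ∀ p → Dec (CheckedInvariant p)
    checkedInvariant? p = all? (λ t → any? (DomIn? p t) vertices ⊎-dec any? (PairIn? p t) vertices) vertices

    checked⇒invariant : ∀ {p} → CheckedInvariant p → PairingInvariant p
    checked⇒invariant checked t = ⊎-map satisfied satisfied (All.lookup checked (∈-vertices t))

  -- Rectangles

  record Grid : Set where
    field
      cell : Side → Side → V G
      cell-injective : ∀ {k l k′ l′} → cell k l ≡ cell k′ l′ → k ≡ k′ × l ≡ l′
      N[leaf] : ∀ {k l u} → k ≢ hub → l ≢ hub → u ∈N[ cell k l ] →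
                u ≡ cell k l ⊎ u ≡ cell k hub ⊎ u ≡ cell hub l

  transpose : Grid → Grid
  transpose g = record
    { cell = λ k l → cell l k
    ; cell-injective = λ e → swap (cell-injective e)
    ; N[leaf] = λ k≢hub l≢hub u∈N → ⊎-map id ⊎-swap (N[leaf] l≢hub k≢hub u∈N)
    }
    where open Grid g

  module _ (g : Grid) where
    open Grid g

    -- A board records the states of the eight cells other than the centre, which the rectangle strategy
    -- never uses; for a concrete sequence of claims the resulting board is computed by mark.
    Agrees : Position → Board → Set
    Agrees p σ = ∀ k l → (k , l) ≢ (hub , hub) → p (cell k l) ≡ σ k l

    OffGrid : V G → Set
    OffGrid d = ∀ k l → (k , l) ≢ (hub , hub) → cell k l ≢ d

    centre-offGrid : OffGrid (cell hub hub)
    centre-offGrid k l kl≢hub e with cell-injective e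
    ... | refl , refl = kl≢hub refl

    agrees-start : Agrees start blank
    agrees-start _ _ _ = refl

    agrees-claim-offGrid : ∀ {p σ d c} → OffGrid d → Agrees p σ → Agrees (claim p d c) σ
    agrees-claim-offGrid off agrees k l kl≢hub = claim-preserves (off k l kl≢hub) (agrees k l kl≢hub)

    agrees-claim : ∀ {p σ} → Agrees p σ → ∀ k l c → Agrees (claim p (cell k l) c) (mark σ k l c)
    agrees-claim {p} agrees k l c k′ l′ kl′≢hub with k ≟ˢ k′ | l ≟ˢ l′
    ... | yes refl | yes refl = claim-here p (cell k l) c
    ... | yes refl | no l≢l′ =
      claim-preserves (λ e → l≢l′ (sym (proj₂ (cell-injective e)))) (agrees k l′ kl′≢hub)
    ... | no k≢k′ | _ =
      claim-preserves (λ e → k≢k′ (sym (proj₁ (cell-injective e)))) (agrees k′ l′ kl′≢hub)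

    leaf-threat : ∀ {p σ} → Agrees p σ → ∀ k l → k ≢ hub → l ≢ hub →
                  σ k l ≡ free → σ k hub ≡ sta → σ hub l ≡ sta → Threat p (cell k l) (cell k l)
    leaf-threat {p} {σ} agrees k l k≢hub l≢hub σkl≡free σkhub≡sta σhubl≡sta =
      trans (agrees k l (k≢hub ∘ cong proj₁)) σkl≡free , neighbour
      where
      neighbour : ∀ {u} → u ∈N[ cell k l ] → u ≡ cell k l ⊎ p u ≡ sta
      neighbour u∈N with N[leaf] k≢hub l≢hub u∈N
      ... | inj₁ u≡cell = inj₁ u≡cell
      ... | inj₂ (inj₁ refl) = inj₂ (trans (agrees k hub (k≢hub ∘ cong proj₁)) σkhub≡sta)
      ... | inj₂ (inj₂ refl) = inj₂ (trans (agrees hub l (l≢hub ∘ cong proj₂)) σhubl≡sta)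

    -- Staller's claims of (hub , one) and (two , hub) force Dominator onto (one , one) and (two , one);
    -- then (hub , two) threatens (one , two) and (two , two) at once.
    rectangle : ∀ {p} → Agrees p (mark blank one hub sta) → SWins p Staller
    rectangle {p} agrees =
      sMove (cell hub one) (agrees hub one λ ())
        (forced (leaf-threat agrees₁ one one (λ ()) (λ ()) refl refl refl)
          (sMove (cell two hub) (agrees₂ two hub λ ())
            (forced (leaf-threat agrees₃ two one (λ ()) (λ ()) refl refl refl)
              (sMove (cell hub two) (agrees₄ hub two λ ())
                (double-threat (leaf-threat agrees₅ one two (λ ()) (λ ()) refl refl refl)
                               (leaf-threat agrees₅ two two (λ ()) (λ ()) refl refl refl)
                               (λ e → case proj₁ (cell-injective e) of λ ()))))))
      where
      q₁ q₂ q₃ q₄ q₅ : Position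
      q₁ = claim p (cell hub one) sta
      q₂ = claim q₁ (cell one one) dom
      q₃ = claim q₂ (cell two hub) sta
      q₄ = claim q₃ (cell two one) dom
      q₅ = claim q₄ (cell hub two) sta
      σ₁ σ₂ σ₃ σ₄ σ₅ : Board
      σ₁ = mark (mark blank one hub sta) hub one sta
      σ₂ = mark σ₁ one one dom
      σ₃ = mark σ₂ two hub sta
      σ₄ = mark σ₃ two one dom
      σ₅ = mark σ₄ hub two sta
      agrees₁ : Agrees q₁ σ₁
      agrees₁ = agrees-claim agrees hub one sta
      agrees₂ : Agrees q₂ σ₂
      agrees₂ = agrees-claim agrees₁ one one dom
      agrees₃ : Agrees q₃ σ₃
      agrees₃ = agrees-claim agrees₂ two hub sta
      agrees₄ : Agrees q₄ σ₄
      agrees₄ = agrees-claim agrees₃ two one dom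
      agrees₅ : Agrees q₅ σ₅
      agrees₅ = agrees-claim agrees₄ hub two sta

    rectangle-after : ∀ {p d} → Agrees p blank → OffGrid d →
                      SWins (claim (claim p (cell one hub) sta) d dom) Staller
    rectangle-after agrees off = rectangle (agrees-claim-offGrid off (agrees-claim agrees one hub sta))

  offGrid-transpose : ∀ {g d} → OffGrid g d → OffGrid (transpose g) d
  offGrid-transpose off k l kl≢hub = off l k (kl≢hub ∘ cong swap)

  -- Fans

  FreeOutside : (V G → Set) → Position → Set
  FreeOutside S p = ∀ u → ¬ S u → p u ≡ free

  freeOutside-start : ∀ {S} → FreeOutside S start
  freeOutside-start _ _ = refl

  freeOutside-claim : ∀ {S} p v c → S v → FreeOutside S p → FreeOutside S (claim p v c)
  freeOutside-claim _ _ _ Sv freeOutside u ¬Su = claim-preserves (λ { refl → ¬Su Sv }) (freeOutside u ¬Su)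

  record Fan (A : V G) (K : ℕ) : Set where
    field
      X : V G
      spoke tip : Fin K → V G
      N[spoke] : ∀ k {u} → u ∈N[ spoke k ] → u ≡ spoke k ⊎ u ≡ A ⊎ u ≡ tip k
      spoke-injective : ∀ {k k′} → spoke k ≡ spoke k′ → k ≡ k′
      tip-injective : ∀ {k k′} → tip k ≡ tip k′ → k ≡ k′
      spoke≢tip : ∀ k k′ → spoke k ≢ tip k′
      X≢spoke : ∀ k → X ≢ spoke k
      X≢tip : ∀ k → X ≢ tip k

  fan-tail : ∀ {A K} → Fan A (suc K) → Fan A K
  fan-tail F = record
    { X = X
    ; spoke = spoke ∘ suc
    ; tip = tip ∘ suc
    ; N[spoke] = N[spoke] ∘ suc
    ; spoke-injective = suc-injective ∘ spoke-injective
    ; tip-injective = suc-injective ∘ tip-injective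
    ; spoke≢tip = λ k k′ → spoke≢tip (suc k) (suc k′)
    ; X≢spoke = X≢spoke ∘ suc
    ; X≢tip = X≢tip ∘ suc
    }
    where open Fan F

  record Ready {A K} (F : Fan A K) (p : Position) : Set where
    open Fan F
    field
      A-sta : p A ≡ sta
      X-free : p X ≡ free
      spoke-free : ∀ k → p (spoke k) ≡ free
      tip-free : ∀ k → p (tip k) ≡ free
      N[A] : ∀ {u} → u ∈N[ A ] → u ≡ X ⊎ p u ≡ sta ⊎ ∃ λ k → u ≡ spoke k

  module _ {A K} (F : Fan A (suc K)) {p : Position} (ready : Ready F p) where
    open Fan F
    open Ready ready

    private
      q r : Position
      q = claim p (spoke zero) sta
      r = claim q (tip zero) dom

    first-spoke-threat : Threat q (spoke zero) (tip zero)
    first-spoke-threat = claim-preserves (≢-sym (spoke≢tip zero zero)) (tip-free zero) , neighbour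
      where
      neighbour : ∀ {u} → u ∈N[ spoke zero ] → u ≡ tip zero ⊎ q u ≡ sta
      neighbour u∈N with N[spoke] zero u∈N
      ... | inj₁ refl = inj₂ (claim-here p _ sta)
      ... | inj₂ (inj₁ refl) = inj₂ (sta-stays (spoke-free zero) A-sta)
      ... | inj₂ (inj₂ refl) = inj₁ refl

    ready-tail : Ready (fan-tail F) r
    ready-tail = record
      { A-sta = sta-stays tip₀-free (sta-stays (spoke-free zero) A-sta)
      ; X-free = claim-preserves (X≢tip zero) (claim-preserves (X≢spoke zero) X-free)
      ; spoke-free = λ k → claim-preserves (spoke≢tip (suc k) zero)
                             (claim-preserves (λ e → case spoke-injective e of λ ()) (spoke-free (suc k)))
      ; tip-free = λ k → claim-preserves (λ e → case tip-injective e of λ ())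
                           (claim-preserves (≢-sym (spoke≢tip zero (suc k))) (tip-free (suc k)))
      ; N[A] = neighbour
      }
      where
      tip₀-free : q (tip zero) ≡ free
      tip₀-free = proj₁ first-spoke-threat
      neighbour : ∀ {u} → u ∈N[ A ] → u ≡ X ⊎ r u ≡ sta ⊎ ∃ λ k → u ≡ spoke (suc k)
      neighbour u∈N with N[A] u∈N
      ... | inj₁ u≡X = inj₁ u≡X
      ... | inj₂ (inj₁ pu) = inj₂ (inj₁ (sta-stays tip₀-free (sta-stays (spoke-free zero) pu)))
      ... | inj₂ (inj₂ (zero , refl)) = inj₂ (inj₁ (sta-stays tip₀-free (claim-here p _ sta)))
      ... | inj₂ (inj₂ (suc k , refl)) = inj₂ (inj₂ (k , refl))

    last-spoke-threat : K ≡ 0 → Threat q A X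
    last-spoke-threat refl = claim-preserves (X≢spoke zero) X-free , neighbour
      where
      neighbour : ∀ {u} → u ∈N[ A ] → u ≡ X ⊎ q u ≡ sta
      neighbour u∈N with N[A] u∈N
      ... | inj₁ u≡X = inj₁ u≡X
      ... | inj₂ (inj₁ pu) = inj₂ (sta-stays (spoke-free zero) pu)
      ... | inj₂ (inj₂ (zero , refl)) = inj₂ (claim-here p _ sta)

  -- Staller claims the spokes in turn, each claim forcing Dominator onto its tip; the claim of the
  -- last spoke also leaves X as the only free vertex of N[A].
  fan-wins : ∀ {A K p} (F : Fan A K) → 0 < K → Ready F p → SWins p Staller
  fan-wins {K = suc zero} F _ ready =
    sMove _ (Ready.spoke-free ready zero)
      (double-threat (first-spoke-threat F ready) (last-spoke-threat F ready refl) (≢-sym (Fan.X≢tip F zero)))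
  fan-wins {K = suc (suc K)} F _ ready =
    sMove _ (Ready.spoke-free ready zero)
      (forced (first-spoke-threat F ready) (fan-wins (fan-tail F) (s≤s z≤n) (ready-tail F ready)))

record Line (k : ℕ) : Set where
  constructor line
  field
    first second : Fin k
    distinct : first ≢ second
open Line

point : ∀ {k} → Line k → Side → Fin (suc k)
point L hub = zero
point L one = suc (first L)
point L two = suc (second L)

point-injective : ∀ {k} (L : Line k) {s s′} → point L s ≡ point L s′ → s ≡ s′
point-injective L {hub} {hub} _ = refl
point-injective L {one} {one} _ = refl
point-injective L {two} {two} _ = refl
point-injective L {one} {two} e = ⊥-elim (distinct L (suc-injective e))
point-injective L {two} {one} e = ⊥-elim (distinct L (suc-injective (sym e)))
point-injective L {hub} {one} ()
point-injective L {hub} {two} ()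
point-injective L {one} {hub} ()
point-injective L {two} {hub} ()

Avoids : ∀ {k} → Line k → Fin k → Set
Avoids L r = first L ≢ r × second L ≢ r

point-avoids : ∀ {k} {L : Line k} {r} → Avoids L r → ∀ s → point L s ≢ suc r
point-avoids _ hub ()
point-avoids (first≢r , _) one e = first≢r (suc-injective e)
point-avoids (_ , second≢r) two e = second≢r (suc-injective e)

fresh₂ : ∀ {k} → 3 ≤ k → (r r′ : Fin k) → ∃ λ i → r ≢ i × r′ ≢ i
fresh₂ (s≤s (s≤s (s≤s _))) zero zero = suc zero , (λ ()) , (λ ())
fresh₂ (s≤s (s≤s (s≤s _))) zero (suc zero) = suc (suc zero) , (λ ()) , (λ ())
fresh₂ (s≤s (s≤s (s≤s _))) zero (suc (suc _)) = suc zero , (λ ()) , (λ ())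
fresh₂ (s≤s (s≤s (s≤s _))) (suc zero) zero = suc (suc zero) , (λ ()) , (λ ())
fresh₂ (s≤s (s≤s (s≤s _))) (suc zero) (suc zero) = zero , (λ ()) , (λ ())
fresh₂ (s≤s (s≤s (s≤s _))) (suc zero) (suc (suc _)) = zero , (λ ()) , (λ ())
fresh₂ (s≤s (s≤s (s≤s _))) (suc (suc _)) zero = suc zero , (λ ()) , (λ ())
fresh₂ (s≤s (s≤s (s≤s _))) (suc (suc _)) (suc zero) = zero , (λ ()) , (λ ())
fresh₂ (s≤s (s≤s (s≤s _))) (suc (suc _)) (suc (suc _)) = zero , (λ ()) , (λ ())

someLine : ∀ {k} → 2 ≤ k → Line k
someLine (s≤s (s≤s _)) = line zero (suc zero) λ ()

lineFromAvoiding : ∀ {k} → 3 ≤ k → (i r : Fin k) → Line k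
lineFromAvoiding 3≤k i r = line i (proj₁ (fresh₂ 3≤k i r)) (proj₁ (proj₂ (fresh₂ 3≤k i r)))

lineFromAvoiding-avoids : ∀ {k} (3≤k : 3 ≤ k) {i r} → i ≢ r → Avoids (lineFromAvoiding 3≤k i r) r
lineFromAvoiding-avoids 3≤k {i} {r} i≢r = i≢r , ≢-sym (proj₂ (proj₂ (fresh₂ 3≤k i r)))

lineAvoiding : ∀ {k} → 3 ≤ k → Fin k → Line k
lineAvoiding 3≤k r = lineFromAvoiding 3≤k (proj₁ (fresh₂ 3≤k r r)) r

lineAvoiding-avoids : ∀ {k} (3≤k : 3 ≤ k) r → Avoids (lineAvoiding 3≤k r) r
lineAvoiding-avoids 3≤k r = lineFromAvoiding-avoids 3≤k (≢-sym (proj₁ (proj₂ (fresh₂ 3≤k r r))))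

star-adj? : ∀ {k} (r r′ : Fin (suc k)) → Dec (Adj (Star k) r r′)
star-adj? r r′ = ((r ≟ᶠ zero) ×-dec ¬? (r′ ≟ᶠ zero)) ⊎-dec ((r′ ≟ᶠ zero) ×-dec ¬? (r ≟ᶠ zero))

module StarProduct (m n : ℕ) where
  Vertex : Set
  Vertex = Fin (suc m) × Fin (suc n)

  vertices : List Vertex
  vertices = cartesianProduct (allFin (suc m)) (allFin (suc n))

  ∈-vertices : ∀ v → v ∈ vertices
  ∈-vertices (r , s) = ∈-cartesianProduct⁺ (∈-allFin r) (∈-allFin s)

  adj? : ∀ u v → Dec (Adj (Star m □ Star n) u v)
  adj? (r , s) (r′ , s′) = (star-adj? r r′ ×-dec (s ≟ᶠ s′)) ⊎-dec ((r ≟ᶠ r′) ×-dec star-adj? s s′)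

  open FiniteGame (Star m □ Star n) vertices ∈-vertices adj? public

  x : Vertex
  x = zero , zero

  a : Fin m → Vertex
  a i = suc i , zero

  b : Fin n → Vertex
  b j = zero , suc j

  c : Fin m → Fin n → Vertex
  c i j = suc i , suc j

  centre~leaf₁ : ∀ {i s} → Adj (Star m □ Star n) (zero , s) (suc i , s)
  centre~leaf₁ = inj₁ (inj₁ (refl , λ ()) , refl)

  leaf~centre₁ : ∀ {i s} → Adj (Star m □ Star n) (suc i , s) (zero , s)
  leaf~centre₁ = inj₁ (inj₂ (refl , λ ()) , refl)

  centre~leaf₂ : ∀ {r j} → Adj (Star m □ Star n) (r , zero) (r , suc j)
  centre~leaf₂ = inj₂ (refl , inj₁ (refl , λ ()))

  N[a] : ∀ {i u} → u ∈N[ a i ] → u ≡ a i ⊎ u ≡ x ⊎ ∃ λ k → u ≡ c i k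
  N[a] (inj₁ refl) = inj₁ refl
  N[a] (inj₂ (inj₁ (inj₁ (refl , _) , refl))) = inj₂ (inj₁ refl)
  N[a] (inj₂ (inj₁ (inj₂ (() , _) , _)))
  N[a] (inj₂ (inj₂ (refl , inj₁ (_ , zero≢zero)))) = ⊥-elim (zero≢zero refl)
  N[a] {u = _ , zero} (inj₂ (inj₂ (refl , inj₂ (_ , zero≢zero)))) = ⊥-elim (zero≢zero refl)
  N[a] {u = _ , suc k} (inj₂ (inj₂ (refl , inj₂ _))) = inj₂ (inj₂ (k , refl))

  N[b] : ∀ {j u} → u ∈N[ b j ] → u ≡ b j ⊎ u ≡ x ⊎ ∃ λ k → u ≡ c k j
  N[b] (inj₁ refl) = inj₁ refl
  N[b] (inj₂ (inj₂ (refl , inj₁ (refl , _)))) = inj₂ (inj₁ refl)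
  N[b] (inj₂ (inj₂ (refl , inj₂ (() , _))))
  N[b] (inj₂ (inj₁ (inj₁ (_ , zero≢zero) , refl))) = ⊥-elim (zero≢zero refl)
  N[b] {u = zero , _} (inj₂ (inj₁ (inj₂ (_ , zero≢zero) , refl))) = ⊥-elim (zero≢zero refl)
  N[b] {u = suc k , _} (inj₂ (inj₁ (inj₂ _ , refl))) = inj₂ (inj₂ (k , refl))

  N[c] : ∀ {i j u} → u ∈N[ c i j ] → u ≡ c i j ⊎ u ≡ a i ⊎ u ≡ b j
  N[c] (inj₁ refl) = inj₁ refl
  N[c] (inj₂ (inj₁ (inj₁ (refl , _) , refl))) = inj₂ (inj₂ refl)
  N[c] (inj₂ (inj₁ (inj₂ (() , _) , _)))
  N[c] (inj₂ (inj₂ (refl , inj₁ (refl , _)))) = inj₂ (inj₁ refl)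
  N[c] (inj₂ (inj₂ (refl , inj₂ (() , _))))

  grid : Line m → Line n → Grid
  grid R C = record
    { cell = λ k l → point R k , point C l
    ; cell-injective = λ e → point-injective R (cong proj₁ e) , point-injective C (cong proj₂ e)
    ; N[leaf] = N[leaf]
    }
    where
    N[leaf] : ∀ {k l u} → k ≢ hub → l ≢ hub → u ∈N[ point R k , point C l ] →
              u ≡ (point R k , point C l) ⊎ u ≡ (point R k , zero) ⊎ u ≡ (zero , point C l)
    N[leaf] {hub} k≢hub _ = ⊥-elim (k≢hub refl)
    N[leaf] {_} {hub} _ l≢hub = ⊥-elim (l≢hub refl)
    N[leaf] {one} {one} _ _ = N[c]
    N[leaf] {one} {two} _ _ = N[c]
    N[leaf] {two} {one} _ _ = N[c]
    N[leaf] {two} {two} _ _ = N[c]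

  row-offGrid : ∀ {R C r s} → Avoids R r → OffGrid (grid R C) (suc r , s)
  row-offGrid avoids k _ _ e = point-avoids avoids k (cong proj₁ e)

  column-offGrid : ∀ {R C r s} → Avoids C s → OffGrid (grid R C) (r , suc s)
  column-offGrid avoids _ l _ e = point-avoids avoids l (cong proj₂ e)

  rowFan : (i : Fin m) → Fan (a i) n
  rowFan i = record
    { X = x
    ; spoke = c i
    ; tip = b
    ; N[spoke] = λ _ → N[c]
    ; spoke-injective = λ { refl → refl }
    ; tip-injective = λ { refl → refl }
    ; spoke≢tip = λ _ _ ()
    ; X≢spoke = λ _ ()
    ; X≢tip = λ _ ()
    }

  columnFan : (j : Fin n) → Fan (b j) m
  columnFan j = record
    { X = x
    ; spoke = λ k → c k j
    ; tip = a
    ; N[spoke] = λ _ u∈N → ⊎-map id ⊎-swap (N[c] u∈N)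
    ; spoke-injective = λ { refl → refl }
    ; tip-injective = λ { refl → refl }
    ; spoke≢tip = λ _ _ ()
    ; X≢spoke = λ _ ()
    ; X≢tip = λ _ ()
    }

  data IsA : Vertex → Set where
    isA : ∀ i → IsA (a i)

  data IsB : Vertex → Set where
    isB : ∀ j → IsB (b j)

  rowFan-ready : ∀ {p i} → FreeOutside IsA p → p (a i) ≡ sta → Ready (rowFan i) p
  rowFan-ready {p} {i} freeOutside pa = record
    { A-sta = pa
    ; X-free = freeOutside _ λ ()
    ; spoke-free = λ _ → freeOutside _ λ ()
    ; tip-free = λ _ → freeOutside _ λ ()
    ; N[A] = neighbour
    }
    where
    neighbour : ∀ {u} → u ∈N[ a i ] → u ≡ x ⊎ p u ≡ sta ⊎ ∃ λ k → u ≡ c i k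
    neighbour u∈N with N[a] u∈N
    ... | inj₁ refl = inj₂ (inj₁ pa)
    ... | inj₂ u≡x⊎spoke = ⊎-map id inj₂ u≡x⊎spoke

  columnFan-ready : ∀ {p j} → FreeOutside IsB p → p (b j) ≡ sta → Ready (columnFan j) p
  columnFan-ready {p} {j} freeOutside pb = record
    { A-sta = pb
    ; X-free = freeOutside _ λ ()
    ; spoke-free = λ _ → freeOutside _ λ ()
    ; tip-free = λ _ → freeOutside _ λ ()
    ; N[A] = neighbour
    }
    where
    neighbour : ∀ {u} → u ∈N[ b j ] → u ≡ x ⊎ p u ≡ sta ⊎ ∃ λ k → u ≡ c k j
    neighbour u∈N with N[b] u∈N
    ... | inj₁ refl = inj₂ (inj₁ pb)
    ... | inj₂ u≡x⊎spoke = ⊎-map id inj₂ u≡x⊎spoke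

  a-injective : ∀ {i i′} → a i ≡ a i′ → i ≡ i′
  a-injective refl = refl

  b-injective : ∀ {j j′} → b j ≡ b j′ → j ≡ j′
  b-injective refl = refl

  c-injective : ∀ {i i′ j j′} → c i j ≡ c i′ j′ → i ≡ i′ × j ≡ j′
  c-injective refl = refl , refl

  rowFan-wins : ∀ p i r → 0 < n → FreeOutside IsA p → claim p (a i) sta (a r) ≡ free →
                SWins (claim (claim p (a i) sta) (a r) dom) Staller
  rowFan-wins p i r 0<n freeOutside ar-free =
    fan-wins (rowFan i) 0<n
      (rowFan-ready (freeOutside-claim _ (a r) dom (isA r) (freeOutside-claim p (a i) sta (isA i) freeOutside))
                    (sta-stays {claim p (a i) sta} {a r} {dom} {a i} ar-free (claim-here p (a i) sta)))

  columnFan-wins : ∀ p j s → 0 < m → FreeOutside IsB p → claim p (b j) sta (b s) ≡ free →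
                   SWins (claim (claim p (b j) sta) (b s) dom) Staller
  columnFan-wins p j s 0<m freeOutside bs-free =
    fan-wins (columnFan j) 0<m
      (columnFan-ready (freeOutside-claim _ (b s) dom (isB s) (freeOutside-claim p (b j) sta (isB j) freeOutside))
                       (sta-stays {claim p (b j) sta} {b s} {dom} {b j} bs-free (claim-here p (b j) sta)))

  staller-wins-S-game : 2 ≤ m → 3 ≤ n → SWins start Staller
  staller-wins-S-game 2≤m 3≤n = staller-claims (a i) x refl refl (λ ()) reply
    where
    R : Line m
    R = someLine 2≤m
    i : Fin m
    i = first R
    q : Position
    q = claim start (a i) sta
    rectangle-avoiding : ∀ d (C : Line n) → OffGrid (grid R C) d → SWins (claim q d dom) Staller
    rectangle-avoiding _ C = rectangle-after (grid R C) (agrees-start (grid R C))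
    reply : ∀ d → q d ≡ free → SWins (claim q d dom) Staller
    reply (zero , zero) _ = rectangle-avoiding x C₀ (centre-offGrid (grid R C₀))
      where
      C₀ : Line n
      C₀ = someLine (<⇒≤ 3≤n)
    reply (suc r , zero) qa = rowFan-wins start i r (<-trans z<s 3≤n) freeOutside-start qa
    reply (zero , suc s) _ = rectangle-avoiding (b s) (lineAvoiding 3≤n s) (column-offGrid (lineAvoiding-avoids 3≤n s))
    reply (suc r , suc s) _ = rectangle-avoiding (c r s) (lineAvoiding 3≤n s) (column-offGrid (lineAvoiding-avoids 3≤n s))

  row-rectangle : ∀ d₁ d₂ (R : Line m) (C : Line n) → OffGrid (grid R C) d₁ → OffGrid (grid R C) d₂ →
                  SWins (claim (claim (claim start d₁ dom) (a (first R)) sta) d₂ dom) Staller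
  row-rectangle _ _ R C off₁ off₂ =
    rectangle-after (grid R C) (agrees-claim-offGrid (grid R C) off₁ (agrees-start (grid R C))) off₂

  column-rectangle : ∀ d₁ d₂ (R : Line m) (C : Line n) → OffGrid (grid R C) d₁ → OffGrid (grid R C) d₂ →
                     SWins (claim (claim (claim start d₁ dom) (b (first C)) sta) d₂ dom) Staller
  column-rectangle _ _ R C off₁ off₂ =
    rectangle-after g (agrees-claim-offGrid g (offGrid-transpose {grid R C} off₁) (agrees-start g))
      (offGrid-transpose {grid R C} off₂)
    where
    g : Grid
    g = transpose (grid R C)

  staller-answers : ∀ d₁ s w → s ≢ d₁ → w ≢ d₁ → w ≢ s →
                    (∀ d₂ → claim (claim start d₁ dom) s sta d₂ ≡ free →
                       SWins (claim (claim (claim start d₁ dom) s sta) d₂ dom) Staller) →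
                    SWins (claim start d₁ dom) Staller
  staller-answers d₁ s w s≢d₁ w≢d₁ =
    staller-claims s w (claim-elsewhere start dom s≢d₁) (claim-elsewhere start dom w≢d₁)

  -- Staller answers Dominator's first vertex by some a i off its row (by b j off its column if it is
  -- some b s₁).  His second vertex then either lies on the same axis, making the row (column) through
  -- her vertex a fan, or some rectangle through her vertex misses both of his vertices.
  module _ (3≤m : 3 ≤ m) (3≤n : 3 ≤ n) where
    private
      R₀ : Line m
      R₀ = someLine (<⇒≤ 3≤m)
      C₀ : Line n
      C₀ = someLine (<⇒≤ 3≤n)

    staller-wins-after-x : SWins (claim start x dom) Staller
    staller-wins-after-x = staller-answers x (a i) (c i (first C₀)) (λ ()) (λ ()) (λ ()) reply
      where
      i : Fin m
      i = first R₀
      q : Position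
      q = claim (claim start x dom) (a i) sta
      reply : ∀ d → q d ≡ free → SWins (claim q d dom) Staller
      reply (zero , zero) ()
      reply (suc r , zero) qa = row-rectangle x (a r) (lineFromAvoiding 3≤m i r) C₀ (centre-offGrid (grid _ C₀))
        (row-offGrid (lineFromAvoiding-avoids 3≤m (free⇒≢claimed qa (λ ()) ∘ cong a ∘ sym)))
      reply (zero , suc s) _ = row-rectangle x (b s) R₀ (lineAvoiding 3≤n s) (centre-offGrid (grid R₀ _))
        (column-offGrid (lineAvoiding-avoids 3≤n s))
      reply (suc r , suc s) _ = row-rectangle x (c r s) R₀ (lineAvoiding 3≤n s) (centre-offGrid (grid R₀ _))
        (column-offGrid (lineAvoiding-avoids 3≤n s))

    staller-wins-after-a : ∀ r₁ → SWins (claim start (a r₁) dom) Staller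
    staller-wins-after-a r₁ =
      staller-answers (a r₁) (a i) (c i (first C₀)) (proj₁ R-avoids ∘ a-injective) (λ ()) (λ ()) reply
      where
      R : Line m
      R = lineAvoiding 3≤m r₁
      R-avoids : Avoids R r₁
      R-avoids = lineAvoiding-avoids 3≤m r₁
      i : Fin m
      i = first R
      q : Position
      q = claim (claim start (a r₁) dom) (a i) sta
      reply : ∀ d → q d ≡ free → SWins (claim q d dom) Staller
      reply (zero , zero) _ = row-rectangle (a r₁) x R C₀ (row-offGrid R-avoids) (centre-offGrid (grid R C₀))
      reply (suc r , zero) qa =
        rowFan-wins _ i r (<-trans z<s 3≤n) (freeOutside-claim start (a r₁) dom (isA r₁) freeOutside-start) qa
      reply (zero , suc s) _ = row-rectangle (a r₁) (b s) R (lineAvoiding 3≤n s) (row-offGrid R-avoids)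
        (column-offGrid (lineAvoiding-avoids 3≤n s))
      reply (suc r , suc s) _ = row-rectangle (a r₁) (c r s) R (lineAvoiding 3≤n s) (row-offGrid R-avoids)
        (column-offGrid (lineAvoiding-avoids 3≤n s))

    staller-wins-after-c : ∀ r₁ s₁ → SWins (claim start (c r₁ s₁) dom) Staller
    staller-wins-after-c r₁ s₁ =
      staller-answers (c r₁ s₁) (a i) (c i (first C₀))
        (λ ()) (proj₁ R-avoids ∘ proj₁ ∘ c-injective) (λ ()) reply
      where
      R : Line m
      R = lineAvoiding 3≤m r₁
      R-avoids : Avoids R r₁
      R-avoids = lineAvoiding-avoids 3≤m r₁
      i : Fin m
      i = first R
      q : Position
      q = claim (claim start (c r₁ s₁) dom) (a i) sta
      reply : ∀ d → q d ≡ free → SWins (claim q d dom) Staller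
      reply (zero , zero) _ = row-rectangle (c r₁ s₁) x R C₀ (row-offGrid R-avoids) (centre-offGrid (grid R C₀))
      reply (suc r , zero) qa = row-rectangle (c r₁ s₁) (a r) (lineFromAvoiding 3≤m i r) (lineAvoiding 3≤n s₁)
        (column-offGrid (lineAvoiding-avoids 3≤n s₁))
        (row-offGrid (lineFromAvoiding-avoids 3≤m (free⇒≢claimed qa (λ ()) ∘ cong a ∘ sym)))
      reply (zero , suc s) _ = row-rectangle (c r₁ s₁) (b s) R (lineAvoiding 3≤n s) (row-offGrid R-avoids)
        (column-offGrid (lineAvoiding-avoids 3≤n s))
      reply (suc r , suc s) _ = row-rectangle (c r₁ s₁) (c r s) R (lineAvoiding 3≤n s) (row-offGrid R-avoids)
        (column-offGrid (lineAvoiding-avoids 3≤n s))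

    staller-wins-after-b : ∀ s₁ → SWins (claim start (b s₁) dom) Staller
    staller-wins-after-b s₁ =
      staller-answers (b s₁) (b j) (c (first R₀) j) (proj₁ C-avoids ∘ b-injective) (λ ()) (λ ()) reply
      where
      C : Line n
      C = lineAvoiding 3≤n s₁
      C-avoids : Avoids C s₁
      C-avoids = lineAvoiding-avoids 3≤n s₁
      j : Fin n
      j = first C
      q : Position
      q = claim (claim start (b s₁) dom) (b j) sta
      reply : ∀ d → q d ≡ free → SWins (claim q d dom) Staller
      reply (zero , zero) _ = column-rectangle (b s₁) x R₀ C (column-offGrid C-avoids) (centre-offGrid (grid R₀ C))
      reply (suc r , zero) _ = column-rectangle (b s₁) (a r) (lineAvoiding 3≤m r) C (column-offGrid C-avoids)
        (row-offGrid (lineAvoiding-avoids 3≤m r))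
      reply (zero , suc s) qb =
        columnFan-wins _ j s (<-trans z<s 3≤m) (freeOutside-claim start (b s₁) dom (isB s₁) freeOutside-start) qb
      reply (suc r , suc s) _ = column-rectangle (b s₁) (c r s) (lineAvoiding 3≤m r) C (column-offGrid C-avoids)
        (row-offGrid (lineAvoiding-avoids 3≤m r))

    staller-wins-D-game : SWins start Dominator
    staller-wins-D-game = dMove (λ allPlayed → allPlayed x refl) reply
      where
      reply : ∀ d → start d ≡ free → SWins (claim start d dom) Staller
      reply (zero , zero) _ = staller-wins-after-x
      reply (suc r , zero) _ = staller-wins-after-a r
      reply (zero , suc s) _ = staller-wins-after-b s
      reply (suc r , suc s) _ = staller-wins-after-c r s

module TwoLeafRows (n : ℕ) where
  open StarProduct 2 n

  mirror : Vertex → Vertex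
  mirror (zero , s) = suc (suc zero) , s
  mirror (suc zero , s) = suc zero , s
  mirror (suc (suc zero) , s) = zero , s

  mirror-involutive : ∀ v → mirror (mirror v) ≡ v
  mirror-involutive (zero , s) = refl
  mirror-involutive (suc zero , s) = refl
  mirror-involutive (suc (suc zero) , s) = refl

  open Pairing mirror
  open Strategy mirror-involutive

  -- a 0 dominates the vertices (1 , s); the adjacent vertices (0 , s) and (2 , s) cover each other.
  covered-after-a₀ : PairingInvariant (claim start (a zero) dom)
  covered-after-a₀ (zero , s) = inj₂ ((zero , s) , ((λ ()) , refl , refl) , inj₁ refl , inj₂ leaf~centre₁)
  covered-after-a₀ (suc (suc zero) , s) = inj₂ ((zero , s) , ((λ ()) , refl , refl) , inj₂ centre~leaf₁ , inj₁ refl)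
  covered-after-a₀ (suc zero , zero) = inj₁ (a zero , refl , inj₁ refl)
  covered-after-a₀ (suc zero , suc j) = inj₁ (a zero , refl , inj₂ centre~leaf₂)

  dominator-wins-D-game : DWins start Dominator
  dominator-wins-D-game = dMove (a zero) refl (pairing-wins covered-after-a₀)

module TwoByTwo where
  open StarProduct 2 2

  pattern 𝟘 = zero
  pattern 𝟙 = suc zero
  pattern 𝟚 = suc (suc zero)

  swapping : List (Vertex × Vertex) → Vertex → Vertex
  swapping [] v = v
  swapping ((u , u′) ∷ pairs) v with v ≟ᵥ u | v ≟ᵥ u′
  ... | yes _ | _     = u′
  ... | no _  | yes _ = u
  ... | no _  | no _  = swapping pairs v

  answer : Vertex → Vertex × List (Vertex × Vertex)
  answer (𝟘 , 𝟘) = (𝟘 , 𝟙) , ((𝟘 , 𝟚) , (𝟙 , 𝟚)) ∷ ((𝟙 , 𝟘) , (𝟙 , 𝟙)) ∷ ((𝟚 , 𝟘) , (𝟚 , 𝟚)) ∷ []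
  answer (𝟘 , 𝟙) = (𝟙 , 𝟘) , ((𝟘 , 𝟘) , (𝟙 , 𝟙)) ∷ ((𝟘 , 𝟚) , (𝟚 , 𝟚)) ∷ ((𝟚 , 𝟘) , (𝟚 , 𝟙)) ∷ []
  answer (𝟘 , 𝟚) = (𝟙 , 𝟘) , ((𝟘 , 𝟘) , (𝟙 , 𝟚)) ∷ ((𝟘 , 𝟙) , (𝟚 , 𝟙)) ∷ ((𝟚 , 𝟘) , (𝟚 , 𝟚)) ∷ []
  answer (𝟙 , 𝟘) = (𝟘 , 𝟙) , ((𝟘 , 𝟘) , (𝟙 , 𝟙)) ∷ ((𝟘 , 𝟚) , (𝟙 , 𝟚)) ∷ ((𝟚 , 𝟘) , (𝟚 , 𝟚)) ∷ []
  answer (𝟙 , 𝟙) = (𝟘 , 𝟙) , ((𝟘 , 𝟚) , (𝟚 , 𝟚)) ∷ ((𝟙 , 𝟘) , (𝟙 , 𝟚)) ∷ ((𝟚 , 𝟘) , (𝟚 , 𝟙)) ∷ []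
  answer (𝟙 , 𝟚) = (𝟘 , 𝟚) , ((𝟘 , 𝟙) , (𝟚 , 𝟙)) ∷ ((𝟙 , 𝟘) , (𝟙 , 𝟙)) ∷ ((𝟚 , 𝟘) , (𝟚 , 𝟚)) ∷ []
  answer (𝟚 , 𝟘) = (𝟘 , 𝟙) , ((𝟘 , 𝟘) , (𝟚 , 𝟙)) ∷ ((𝟘 , 𝟚) , (𝟚 , 𝟚)) ∷ ((𝟙 , 𝟘) , (𝟙 , 𝟚)) ∷ []
  answer (𝟚 , 𝟙) = (𝟘 , 𝟙) , ((𝟘 , 𝟚) , (𝟙 , 𝟚)) ∷ ((𝟙 , 𝟘) , (𝟙 , 𝟙)) ∷ ((𝟚 , 𝟘) , (𝟚 , 𝟚)) ∷ []
  answer (𝟚 , 𝟚) = (𝟘 , 𝟚) , ((𝟘 , 𝟙) , (𝟙 , 𝟙)) ∷ ((𝟙 , 𝟘) , (𝟙 , 𝟚)) ∷ ((𝟚 , 𝟘) , (𝟚 , 𝟙)) ∷ []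

  reply : Vertex → Vertex
  reply = proj₁ ∘ answer

  partner : Vertex → Vertex → Vertex
  partner v = swapping (proj₂ (answer v))

  AnswerWorks : Vertex → Set
  AnswerWorks v = claim start v sta (reply v) ≡ free ×
                  All (λ u → partner v (partner v u) ≡ u) vertices ×
                  Pairing.CheckedInvariant (partner v) (claim (claim start v sta) (reply v) dom)

  answerWorks? : ∀ v → Dec (AnswerWorks v)
  answerWorks? v = (claim start v sta (reply v) ≟ᶜ free) ×-dec
                   all? (λ u → partner v (partner v u) ≟ᵥ u) vertices ×-dec
                   Pairing.checkedInvariant? (partner v) _

  every-answer-works : All AnswerWorks vertices
  every-answer-works = toWitness {a? = all? answerWorks? vertices} tt

  dominator-wins-S-game : DWins start Staller
  dominator-wins-S-game = sMove (λ allPlayed → allPlayed x refl) respond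
    where
    respond : ∀ v → start v ≡ free → DWins (claim start v sta) Dominator
    respond v _ = dMove (reply v) reply-free
      (Pairing.Strategy.pairing-wins (partner v) (λ u → All.lookup involutive (∈-vertices u))
                                     (Pairing.checked⇒invariant (partner v) checked))
      where
      works : AnswerWorks v
      works = All.lookup every-answer-works (∈-vertices v)
      reply-free : claim start v sta (reply v) ≡ free
      reply-free = proj₁ works
      involutive : All (λ u → partner v (partner v u) ≡ u) vertices
      involutive = proj₁ (proj₂ works)
      checked : Pairing.CheckedInvariant (partner v) (claim (claim start v sta) (reply v) dom)
      checked = proj₂ (proj₂ works)

theorem4p3 : (m n : ℕ) → 2 ≤ m → m ≤ n →
    (m ≡ 2 → n ≡ 2 → HasOutcome (Star m □ Star n) 𝒟) ×
    (m ≡ 2 → n ≥ 3 → HasOutcome (Star m □ Star n) 𝒩) ×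
    (m ≥ 3 → HasOutcome (Star m □ Star n) 𝒮)
theorem4p3 m n 2≤m m≤n = outcome-𝒟 , outcome-𝒩 , outcome-𝒮
  where
  outcome-𝒟 : m ≡ 2 → n ≡ 2 → HasOutcome (Star m □ Star n) 𝒟
  outcome-𝒟 refl refl = TwoLeafRows.dominator-wins-D-game 2 , TwoByTwo.dominator-wins-S-game

  outcome-𝒩 : m ≡ 2 → n ≥ 3 → HasOutcome (Star m □ Star n) 𝒩
  outcome-𝒩 refl 3≤n = TwoLeafRows.dominator-wins-D-game n , StarProduct.staller-wins-S-game 2 n ≤-refl 3≤n

  outcome-𝒮 : m ≥ 3 → HasOutcome (Star m □ Star n) 𝒮
  outcome-𝒮 3≤m = StarProduct.staller-wins-D-game m n 3≤m 3≤n , StarProduct.staller-wins-S-game m n 2≤m 3≤n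
    where
    3≤n : 3 ≤ n
    3≤n = ≤-trans 3≤m m≤n
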